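{- Let $G$ be a connected chordal graph and $X$ be a vertex subset such that $G[X]$ is connected. Then there is a bijection $f$ from the set of connected components of $G[N_G(X)]$ to the set of connected components of $G-X$ such that a connected component $C$ of $G[N_G(X)]$ is contained in a connected component $H$ of $G-X$ if and only if $H=f(C)$.
   Context: A graph is chordal if it has no induced cycle of length at least $4$. For $X\subseteq V(G)$, $N_G(X)=\left(\bigcup_{v\in X}N_G(v)\right)\setminus X$. -}

module Defs where

open import Data.Nat using (ℕ; _≤_; _∸_)
import Data.Nat as N
open import Data.Fin using (Fin; toℕ; zero; suc)
open import Data.Fin.Subset using (Subset; _∈_; _∉_; _⊆_; ∁; inside; outside)
open import Data.Bool using (Bool; true; false; not; _∧_; _∨_)
open import Data.Vec using (tabulate; lookup)
open import Data.Product using (Σ; ∃; _×_; _,_)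
open import Data.Sum using (_⊎_)
open import Relation.Binary.PropositionalEquality using (_≡_)
open import Function.Definitions using (Injective)
open import Data.Empty using (⊥)

record Graph (n : ℕ) : Set where
  field
    adj     : Fin n → Fin n → Bool
    symm    : ∀ u v → adj u v ≡ adj v u
    irrefl  : ∀ u → adj u u ≡ false

open Graph public

Adj : ∀ {n} → Graph n → Fin n → Fin n → Set
Adj G u v = adj G u v ≡ true

anyV : ∀ {n} → (Fin n → Bool) → Bool
anyV {N.zero}  p = false
anyV {N.suc n} p = p zero ∨ anyV (λ i → p (suc i))

Nbh : ∀ {n} → Graph n → Subset n → Subset n
Nbh G X = tabulate λ v →
  not (lookup X v) ∧ anyV (λ u → lookup X u ∧ adj G u v)

minus : ∀ {n} → Subset n → Subset n
minus X = ∁ X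

full : ∀ {n} → Subset n
full = tabulate λ _ → inside

-- A walk from u to v all of whose vertices lie in S (i.e. a walk in G[S]).
data Walk {n : ℕ} (G : Graph n) (S : Subset n) : Fin n → Fin n → Set where
  here : ∀ {u} → u ∈ S → Walk G S u u
  step : ∀ {u w v} → u ∈ S → Adj G u w → Walk G S w v → Walk G S u v

Connected : ∀ {n} → Graph n → Subset n → Set
Connected G S = (∃ λ u → u ∈ S) × (∀ u v → u ∈ S → v ∈ S → Walk G S u v)

-- C (a vertex set) is (the vertex set of) a connected component of G[S]:
-- a maximal vertex subset of S inducing a connected subgraph.
IsComponent : ∀ {n} → Graph n → Subset n → Subset n → Set
IsComponent G S C =
  C ⊆ S × Connected G C ×
  (∀ D → D ⊆ S → Connected G D → C ⊆ D → D ⊆ C)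

CycAdj : ∀ {k} → Fin k → Fin k → Set
CycAdj {k} i j =
  N.suc (toℕ i) ≡ toℕ j ⊎ N.suc (toℕ j) ≡ toℕ i ⊎
  (toℕ i ≡ k ∸ 1 × toℕ j ≡ 0) ⊎ (toℕ j ≡ k ∸ 1 × toℕ i ≡ 0)

record InducedCycle {n : ℕ} (G : Graph n) (k : ℕ) : Set where
  field
    vert    : Fin k → Fin n
    inj     : Injective _≡_ _≡_ vert
    adjIff  : ∀ i j → (Adj G (vert i) (vert j) → CycAdj i j)
                    × (CycAdj i j → Adj G (vert i) (vert j))

Chordal : ∀ {n} → Graph n → Set
Chordal G = ∀ k → 4 ≤ k → InducedCycle G k → ⊥

module Submission where

-- Write N = N_G(X) and Far = V - (X ∪ N).  As N is
-- disjoint from X, each component C of G[N] lies in a component f(C) of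
-- G - X, the only component of G - X containing C.  This f is the required
-- map, and it remains to see that it is a bijection.
--   * Surjectivity: G is connected and X nonempty, so a walk from a component
--     H of G - X into X leaves H at a vertex of N; the component C of that
--     vertex in G[N] satisfies f(C) = H.
--   * Injectivity: a walk of G - X between vertices of N can be rerouted
--     inside G[N].  It suffices to bridge a stretch a, t, …, u, c with a, c in
--     N and inner vertices in Far: if a ≠ c, continue it through c and the
--     connected set X to an X-neighbour of a, and shorten this to an induced
--     path, which still passes through c.  By the chordal fan lemma (a vertex
--     adjacent to both ends of an induced path is adjacent to all of it, as
--     otherwise there is a hole of length at least 4) a is adjacent to c.

open import Defs
open import Data.Nat using (ℕ; zero; suc; s≤s)
import Data.Nat.Properties as ℕ
open import Data.Fin using (Fin; zero; suc; toℕ)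
open import Data.Fin.Properties using (any?) renaming (_≟_ to _≟ᶠ_)
open import Data.Fin.Subset using (Subset; _∈_; _∉_; _⊆_; _⊃_; ∁; _∪_; ⁅_⁆)
open import Data.Fin.Subset.Properties
  using (_∈?_; x∈⁅x⁆; x∈⁅y⁆⇒x≡y; ⊆-antisym; p⊆p∪q; q⊆p∪q; x∈p∪q⁻; x∈p∪q⁺; x∈∁p⇒x∉p; x∉p⇒x∈∁p)
open import Data.Fin.Subset.Induction using (⊃-wellFounded)
open import Induction.WellFounded using (Acc; acc)
open import Data.Bool using (Bool; true; false; not; _∧_)
import Data.Bool.Properties as Bool
import Data.Vec as Vec
open import Data.Vec.Properties using ([]=⇒lookup; lookup⇒[]=; lookup∘tabulate)
open import Data.List using (List; []; _∷_; _++_; [_]; length; lookup)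
open import Data.List.Properties using (++-assoc; length-++-≤ʳ)
open import Data.List.Relation.Unary.All as All using (All; []; _∷_)
import Data.List.Relation.Unary.All.Properties as All
open import Data.List.Relation.Unary.Any as Any using (Any; here; there)
import Data.List.Relation.Unary.Any.Properties as Any
open import Data.List.Membership.Propositional using () renaming (_∈_ to _∈ₗ_; _∉_ to _∉ₗ_)
open import Data.List.Membership.Propositional.Properties using (∈-lookup; ∈-∃++)
open import Data.Unit using (⊤; tt)
open import Function using (_∘_)
open import Data.Product using (Σ; ∃; ∃₂; _×_; _,_; proj₁; proj₂)
open import Data.Sum as Sum using (_⊎_; inj₁; inj₂)
open import Data.Empty using (⊥-elim)
open import Relation.Nullary using (¬_; Dec; yes; no)
open import Relation.Nullary.Decidable using (_×-dec_; ¬?)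
open import Relation.Binary.PropositionalEquality using (_≡_; _≢_; refl; sym; trans; cong; subst)

module _ {A : Set} {P : A → Set} (P? : ∀ x → Dec (P x)) where

  first-hit : ∀ L → Any P L →
              ∃₂ λ ms r → ∃ λ R → L ≡ ms ++ r ∷ R × All (λ w → ¬ P w) ms × P r
  first-hit (x ∷ xs) hit with P? x
  ... | yes px = [] , x , xs , refl , [] , px
  ... | no ¬px with hit
  ...   | here px   = ⊥-elim (¬px px)
  ...   | there hit′ =
    let (ms , r , R , e , ¬ms , pr) = first-hit xs hit′
    in x ∷ ms , r , R , cong (x ∷_) e , ¬px ∷ ¬ms , pr

  last-hit : ∀ L → Any P L →
             ∃₂ λ ms r → ∃ λ R → L ≡ ms ++ r ∷ R × P r × All (λ w → ¬ P w) R
  last-hit (x ∷ xs) hit with Any.any? P? xs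
  ... | yes hit′ =
    let (ms , r , R , e , pr , ¬R) = last-hit xs hit′
    in x ∷ ms , r , R , cong (x ∷_) e , pr , ¬R
  ... | no ¬hit with hit
  ...   | here px    = [] , x , xs , refl , px , All.¬Any⇒All¬ xs ¬hit
  ...   | there hit′ = ⊥-elim (¬hit hit′)

data Last {A : Set} (y : A) : List A → Set where
  last-here  : Last y [ y ]
  last-there : ∀ {x xs} → Last y xs → Last y (x ∷ xs)

last-∈ : ∀ {A : Set} {y : A} {L} → Last y L → y ∈ₗ L
last-∈ last-here      = here refl
last-∈ (last-there l) = there (last-∈ l)

last-suffix : ∀ {A : Set} {y x : A} pre {xs} → Last y (pre ++ x ∷ xs) → Last y (x ∷ xs)
last-suffix []            l              = l
last-suffix (_ ∷ [])      (last-there l) = l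
last-suffix (_ ∷ p ∷ pre) (last-there l) = last-suffix (p ∷ pre) l

∉⇒lookup-false : ∀ {n} {S : Subset n} {v} → v ∉ S → Vec.lookup S v ≡ false
∉⇒lookup-false {S = S} {v} v∉S with Vec.lookup S v in Sv
... | true  = ⊥-elim (v∉S (lookup⇒[]= v S Sv))
... | false = refl

∈-full : ∀ {n} {v : Fin n} → v ∈ full
∈-full {v = v} = lookup⇒[]= v full (lookup∘tabulate _ v)

anyV-sound : ∀ {m} (p : Fin m → Bool) → anyV p ≡ true → ∃ λ i → p i ≡ true
anyV-sound {zero}  p ()
anyV-sound {suc m} p found with p zero in p0
... | true  = zero , p0
... | false = let (i , pi) = anyV-sound (p ∘ suc) found in suc i , pi

anyV-complete : ∀ {m} (p : Fin m → Bool) i → p i ≡ true → anyV p ≡ true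
anyV-complete p zero    pi rewrite pi = refl
anyV-complete p (suc i) pi rewrite anyV-complete (p ∘ suc) i pi = Bool.∨-zeroʳ (p zero)

∪⁅⁆⊆ : ∀ {n} {D S : Subset n} {w} → D ⊆ S → w ∈ S → D ∪ ⁅ w ⁆ ⊆ S
∪⁅⁆⊆ {D = D} D⊆S w∈S x∈ with x∈p∪q⁻ D _ x∈
... | inj₁ x∈D = D⊆S x∈D
... | inj₂ x≡w rewrite x∈⁅y⁆⇒x≡y _ x≡w = w∈S

module _ {n : ℕ} (G : Graph n) where

  adj-sym : ∀ {u v} → Adj G u v → Adj G v u
  adj-sym {u} {v} uv = trans (symm G v u) uv

  adj-irrefl : ∀ {u} → ¬ Adj G u u
  adj-irrefl {u} uu with trans (sym uu) (irrefl G u)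
  ... | ()

  adj? : ∀ u v → Dec (Adj G u v)
  adj? u v = adj G u v Bool.≟ true

  walk-start : ∀ {S u v} → Walk G S u v → u ∈ S
  walk-start (here u∈S)     = u∈S
  walk-start (step u∈S _ _) = u∈S

  walk-end : ∀ {S u v} → Walk G S u v → v ∈ S
  walk-end (here v∈S)   = v∈S
  walk-end (step _ _ w) = walk-end w

  walk-mono : ∀ {S T u v} → S ⊆ T → Walk G S u v → Walk G T u v
  walk-mono S⊆T (here u∈S)      = here (S⊆T u∈S)
  walk-mono S⊆T (step u∈S uw w) = step (S⊆T u∈S) uw (walk-mono S⊆T w)

  walk-++ : ∀ {S u v w} → Walk G S u v → Walk G S v w → Walk G S u w
  walk-++ (here _)        q = q
  walk-++ (step u∈S uw p) q = step u∈S uw (walk-++ p q)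

  walk-snoc : ∀ {S u v w} → Walk G S u v → Adj G v w → w ∈ S → Walk G S u w
  walk-snoc p vw w∈S = walk-++ p (step (walk-end p) vw (here w∈S))

  edge-walk : ∀ {S u v} → u ∈ S → v ∈ S → u ≡ v ⊎ Adj G u v → Walk G S u v
  edge-walk u∈S _   (inj₁ refl) = here u∈S
  edge-walk u∈S v∈S (inj₂ uv)   = step u∈S uv (here v∈S)

  connected-extend : ∀ {D u w} → Connected G D → u ∈ D → Adj G u w → Connected G (D ∪ ⁅ w ⁆)
  connected-extend {D} {u} {w} ((d , d∈D) , walks) u∈D uw = (d , ⊆D′ d∈D) , walks′
    where
    ⊆D′ : D ⊆ D ∪ ⁅ w ⁆
    ⊆D′ = p⊆p∪q _
    w∈D′ : w ∈ D ∪ ⁅ w ⁆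
    w∈D′ = q⊆p∪q D _ (x∈⁅x⁆ w)
    walks′ : ∀ x y → x ∈ D ∪ ⁅ w ⁆ → y ∈ D ∪ ⁅ w ⁆ → Walk G (D ∪ ⁅ w ⁆) x y
    walks′ x y x∈ y∈ with x∈p∪q⁻ D _ x∈ | x∈p∪q⁻ D _ y∈
    ... | inj₁ x∈D | inj₁ y∈D = walk-mono ⊆D′ (walks x y x∈D y∈D)
    ... | inj₁ x∈D | inj₂ y≡w rewrite x∈⁅y⁆⇒x≡y _ y≡w =
      walk-snoc (walk-mono ⊆D′ (walks x u x∈D u∈D)) uw w∈D′
    ... | inj₂ x≡w | inj₁ y∈D rewrite x∈⁅y⁆⇒x≡y _ x≡w =
      step w∈D′ (adj-sym uw) (walk-mono ⊆D′ (walks u y u∈D y∈D))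
    ... | inj₂ x≡w | inj₂ y≡w rewrite x∈⁅y⁆⇒x≡y _ x≡w | x∈⁅y⁆⇒x≡y _ y≡w = here w∈D′

  -- Components.  E is closed in S when no edge of G[S] leaves E.  Components
  -- of G[S] are exactly the connected closed subsets of S.

  Closed : Subset n → Subset n → Set
  Closed S E = ∀ {u w} → u ∈ E → w ∈ S → Adj G u w → w ∈ E

  closed-walk : ∀ {S E u v} → Closed S E → u ∈ E → Walk G S u v → v ∈ E
  closed-walk closed u∈E (here _)      = u∈E
  closed-walk closed u∈E (step _ uw p) = closed-walk closed (closed u∈E (walk-start p) uw) p

  component-closed : ∀ {S H} → IsComponent G S H → Closed S H
  component-closed {S} {H} (H⊆S , conn , maximal) {u} {w} u∈H w∈S uw =
    maximal (H ∪ ⁅ w ⁆) (∪⁅⁆⊆ H⊆S w∈S) (connected-extend conn u∈H uw) (p⊆p∪q _) (q⊆p∪q H _ (x∈⁅x⁆ w))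

  closed-component : ∀ {S E} → E ⊆ S → Connected G E → Closed S E → IsComponent G S E
  closed-component {S} {E} E⊆S ((e , e∈E) , walks) closed = E⊆S , ((e , e∈E) , walks) , maximal
    where
    maximal : ∀ D → D ⊆ S → Connected G D → E ⊆ D → D ⊆ E
    maximal D D⊆S (_ , walksD) E⊆D x∈D =
      closed-walk closed e∈E (walk-mono D⊆S (walksD _ _ (E⊆D e∈E) x∈D))

  component-absorbs : ∀ {S H D v} → IsComponent G S H → D ⊆ S → Connected G D →
                      v ∈ D → v ∈ H → D ⊆ H
  component-absorbs H-comp D⊆S (_ , walksD) v∈D v∈H x∈D =
    closed-walk (component-closed H-comp) v∈H (walk-mono D⊆S (walksD _ _ v∈D x∈D))

  component-unique : ∀ {S H H′ v} → IsComponent G S H → IsComponent G S H′ →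
                     v ∈ H → v ∈ H′ → H ≡ H′
  component-unique H-comp@(H⊆S , H-conn , _) H′-comp@(H′⊆S , H′-conn , _) v∈H v∈H′ =
    ⊆-antisym (component-absorbs H′-comp H⊆S H-conn v∈H v∈H′)
              (component-absorbs H-comp H′⊆S H′-conn v∈H′ v∈H)

  -- Grow a connected D ⊆ S by neighbours in S until it is closed; this
  -- terminates because the grown sets strictly increase.
  close-up : ∀ {S} D → Acc _⊃_ D → D ⊆ S → Connected G D →
             ∃ λ E → D ⊆ E × E ⊆ S × Connected G E × Closed S E
  close-up {S} D (acc smaller) D⊆S conn
    with any? (λ w → w ∈? S ×-dec ¬? (w ∈? D) ×-dec any? (λ u → u ∈? D ×-dec adj? u w))
  ... | yes (w , w∈S , w∉D , u , u∈D , uw) =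
    let (E , D′⊆E , rest) = close-up (D ∪ ⁅ w ⁆) (smaller (p⊆p∪q _ , w , q⊆p∪q D _ (x∈⁅x⁆ w) , w∉D))
                                     (∪⁅⁆⊆ D⊆S w∈S) (connected-extend conn u∈D uw)
    in E , D′⊆E ∘ p⊆p∪q _ , rest
  ... | no no-exit = D , (λ x∈D → x∈D) , D⊆S , conn , closed
    where
    closed : Closed S D
    closed {u} {w} u∈D w∈S uw with w ∈? D
    ... | yes w∈D = w∈D
    ... | no  w∉D = ⊥-elim (no-exit (w , w∈S , w∉D , u , u∈D , uw))

  component-of : ∀ {S v} → v ∈ S → ∃ λ H → IsComponent G S H × v ∈ H
  component-of {S} {v} v∈S =
    let (H , v⊆H , H⊆S , H-conn , H-closed) = close-up ⁅ v ⁆ (⊃-wellFounded _) v⊆S ((v , x∈⁅x⁆ v) , walks)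
    in H , closed-component H⊆S H-conn H-closed , v⊆H (x∈⁅x⁆ v)
    where
    v⊆S : ⁅ v ⁆ ⊆ S
    v⊆S x∈ rewrite x∈⁅y⁆⇒x≡y _ x∈ = v∈S
    walks : ∀ x y → x ∈ ⁅ v ⁆ → y ∈ ⁅ v ⁆ → Walk G ⁅ v ⁆ x y
    walks x y x∈ y∈ rewrite x∈⁅y⁆⇒x≡y _ x∈ | x∈⁅y⁆⇒x≡y _ y∈ = here (x∈⁅x⁆ v)

  Continues : Fin n → List (Fin n) → Set
  Continues x []       = ⊤
  Continues x (y ∷ ys) = Adj G x y × All (λ w → ¬ Adj G x w) ys × x ∉ₗ y ∷ ys

  InducedPath : List (Fin n) → Set
  InducedPath []       = ⊤
  InducedPath (x ∷ xs) = Continues x xs × InducedPath xs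

  induced-prefix : ∀ A B → InducedPath (A ++ B) → InducedPath A
  induced-prefix []      B _              = tt
  induced-prefix (x ∷ A) B (cont , path) = continues A cont , induced-prefix A B path
    where
    continues : ∀ A → Continues x (A ++ B) → Continues x A
    continues []      _                = tt
    continues (y ∷ A) (xy , ¬x⋯ , x∉) = xy , All.++⁻ˡ A ¬x⋯ , x∉ ∘ Any.++⁺ˡ

  induced-suffix : ∀ A B → InducedPath (A ++ B) → InducedPath B
  induced-suffix []      B path      = path
  induced-suffix (_ ∷ A) B (_ , path) = induced-suffix A B path

  induced-injective : ∀ L → InducedPath L → ∀ i j → lookup L i ≡ lookup L j → i ≡ j
  induced-injective (x ∷ xs) _ zero zero _ = refl
  induced-injective (x ∷ y ∷ ys) ((_ , _ , x∉) , _) zero (suc j) e =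
    ⊥-elim (x∉ (subst (_∈ₗ y ∷ ys) (sym e) (∈-lookup j)))
  induced-injective (x ∷ y ∷ ys) ((_ , _ , x∉) , _) (suc i) zero e =
    ⊥-elim (x∉ (subst (_∈ₗ y ∷ ys) e (∈-lookup i)))
  induced-injective (x ∷ xs) (_ , path) (suc i) (suc j) e = cong suc (induced-injective xs path i j e)

  Consecutive : ∀ {m} → Fin m → Fin m → Set
  Consecutive i j = suc (toℕ i) ≡ toℕ j ⊎ suc (toℕ j) ≡ toℕ i

  induced-adjacent : ∀ L → InducedPath L → ∀ i j →
    (Adj G (lookup L i) (lookup L j) → Consecutive i j) ×
    (Consecutive i j → Adj G (lookup L i) (lookup L j))
  induced-adjacent (x ∷ xs) _ zero zero = ⊥-elim ∘ adj-irrefl , λ { (inj₁ ()) ; (inj₂ ()) }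
  induced-adjacent (x ∷ y ∷ ys) ((xy , _ , _) , _) zero (suc zero) = (λ _ → inj₁ refl) , (λ _ → xy)
  induced-adjacent (x ∷ y ∷ ys) ((_ , ¬x⋯ , _) , _) zero (suc (suc j)) =
    (λ a → ⊥-elim (All.lookup ¬x⋯ (∈-lookup j) a)) , λ { (inj₁ ()) ; (inj₂ ()) }
  induced-adjacent (x ∷ y ∷ ys) ((xy , _ , _) , _) (suc zero) zero = (λ _ → inj₂ refl) , (λ _ → adj-sym xy)
  induced-adjacent (x ∷ y ∷ ys) ((_ , ¬x⋯ , _) , _) (suc (suc i)) zero =
    (λ a → ⊥-elim (All.lookup ¬x⋯ (∈-lookup i) (adj-sym a))) , λ { (inj₁ ()) ; (inj₂ ()) }
  induced-adjacent (x ∷ xs) (_ , path) (suc i) (suc j) =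
    let (to , from) = induced-adjacent xs path i j
    in (Sum.map (cong suc) (cong suc) ∘ to) , (from ∘ Sum.map ℕ.suc-injective ℕ.suc-injective)

  adjacent-only-last : ∀ {z r} ms → All (λ w → ¬ Adj G z w) ms → Adj G z r → ∀ j →
    (Adj G z (lookup (ms ++ [ r ]) j) → suc (toℕ j) ≡ length (ms ++ [ r ])) ×
    (suc (toℕ j) ≡ length (ms ++ [ r ]) → Adj G z (lookup (ms ++ [ r ]) j))
  adjacent-only-last []       _          zr zero = (λ _ → refl) , (λ _ → zr)
  adjacent-only-last {r = r} (m ∷ ms) (¬zm ∷ _) _ zero =
    ⊥-elim ∘ ¬zm , λ e → ⊥-elim (ℕ.<⇒≢ (length-++-≤ʳ [ r ] {ms}) (ℕ.suc-injective e))
  adjacent-only-last (m ∷ ms) (_ ∷ ¬zms) zr (suc j) =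
    let (to , from) = adjacent-only-last ms ¬zms zr j
    in (cong suc ∘ to) , (from ∘ ℕ.suc-injective)

  hole : ∀ {z x r} ms → InducedPath (x ∷ ms ++ [ r ]) → z ∉ₗ x ∷ ms ++ [ r ] →
         Adj G z x → All (λ w → ¬ Adj G z w) ms → Adj G z r →
         InducedCycle G (suc (length (x ∷ ms ++ [ r ])))
  hole {z} {x} {r} ms path z∉ zx ¬zms zr = record { vert = vert ; inj = inj ; adjIff = adjIff }
    where
    L : List (Fin n)
    L = x ∷ ms ++ [ r ]

    vert : Fin (suc (length L)) → Fin n
    vert = lookup (z ∷ L)

    inj : ∀ {i j} → vert i ≡ vert j → i ≡ j
    inj {zero}  {zero}  _ = refl
    inj {zero}  {suc j} e = ⊥-elim (z∉ (subst (_∈ₗ L) (sym e) (∈-lookup j)))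
    inj {suc i} {zero}  e = ⊥-elim (z∉ (subst (_∈ₗ L) e (∈-lookup i)))
    inj {suc i} {suc j} e = cong suc (induced-injective L path i j e)

    z-adjacent : ∀ j → (Adj G z (lookup L j) → toℕ j ≡ 0 ⊎ suc (toℕ j) ≡ length L) ×
                       (toℕ j ≡ 0 ⊎ suc (toℕ j) ≡ length L → Adj G z (lookup L j))
    z-adjacent zero    = (λ _ → inj₁ refl) , (λ _ → zx)
    z-adjacent (suc j) =
      let (to , from) = adjacent-only-last ms ¬zms zr j
      in (inj₂ ∘ cong suc ∘ to) , λ { (inj₁ ()) ; (inj₂ e) → from (ℕ.suc-injective e) }

    -- Position 0 (z) is cyclically next to 1 (x) and to the last position (r);
    -- the remaining positions are those of the induced path L shifted by one.
    adjIff : ∀ i j → (Adj G (vert i) (vert j) → CycAdj i j) × (CycAdj i j → Adj G (vert i) (vert j))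
    adjIff zero zero = ⊥-elim ∘ adj-irrefl ,
      λ { (inj₁ ()) ; (inj₂ (inj₁ ())) ; (inj₂ (inj₂ (inj₁ (() , _)))) ; (inj₂ (inj₂ (inj₂ (() , _)))) }
    adjIff zero (suc j) = let (to , from) = z-adjacent j in (into ∘ to) , (from ∘ back)
      where
      into : toℕ j ≡ 0 ⊎ suc (toℕ j) ≡ length L → CycAdj {suc (length L)} zero (suc j)
      into (inj₁ e) = inj₁ (cong suc (sym e))
      into (inj₂ e) = inj₂ (inj₂ (inj₂ (e , refl)))
      back : CycAdj {suc (length L)} zero (suc j) → toℕ j ≡ 0 ⊎ suc (toℕ j) ≡ length L
      back (inj₁ e)                     = inj₁ (sym (ℕ.suc-injective e))
      back (inj₂ (inj₁ ()))
      back (inj₂ (inj₂ (inj₁ (() , _))))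
      back (inj₂ (inj₂ (inj₂ (e , _)))) = inj₂ e
    adjIff (suc i) zero = let (to , from) = z-adjacent i in (into ∘ to ∘ adj-sym) , (adj-sym ∘ from ∘ back)
      where
      into : toℕ i ≡ 0 ⊎ suc (toℕ i) ≡ length L → CycAdj {suc (length L)} (suc i) zero
      into (inj₁ e) = inj₂ (inj₁ (cong suc (sym e)))
      into (inj₂ e) = inj₂ (inj₂ (inj₁ (e , refl)))
      back : CycAdj {suc (length L)} (suc i) zero → toℕ i ≡ 0 ⊎ suc (toℕ i) ≡ length L
      back (inj₁ ())
      back (inj₂ (inj₁ e))              = inj₁ (sym (ℕ.suc-injective e))
      back (inj₂ (inj₂ (inj₁ (e , _)))) = inj₂ e
      back (inj₂ (inj₂ (inj₂ (() , _))))
    adjIff (suc i) (suc j) = let (to , from) = induced-adjacent L path i j in (into ∘ to) , (from ∘ back)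
      where
      into : Consecutive i j → CycAdj {suc (length L)} (suc i) (suc j)
      into (inj₁ e) = inj₁ (cong suc e)
      into (inj₂ e) = inj₂ (inj₁ (cong suc e))
      back : CycAdj {suc (length L)} (suc i) (suc j) → Consecutive i j
      back (inj₁ e)                      = inj₁ (ℕ.suc-injective e)
      back (inj₂ (inj₁ e))               = inj₂ (ℕ.suc-injective e)
      back (inj₂ (inj₂ (inj₁ (_ , ()))))
      back (inj₂ (inj₂ (inj₂ (_ , ()))))

  -- In a chordal graph, a vertex z off an induced path and adjacent to both
  -- of its ends is adjacent to all of its vertices: otherwise z and the path
  -- up to the first neighbour of z after a non-neighbour form a hole of
  -- length at least 4.
  chordal-fan : Chordal G → ∀ {z x y} xs → InducedPath (x ∷ xs) → z ∉ₗ x ∷ xs →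
                Adj G z x → Last y (x ∷ xs) → Adj G z y → All (Adj G z) xs
  chordal-fan chordal [] _ _ _ _ _ = []
  chordal-fan chordal {z} {x} (x₁ ∷ xs) path z∉ zx end zy with adj? z x₁
  ... | yes zx₁ =
    zx₁ ∷ chordal-fan chordal xs (proj₂ path) (z∉ ∘ there) zx₁ (last-suffix [ x ] end) zy
  ... | no ¬zx₁ with first-hit (adj? z) (x₁ ∷ xs) (Any.map (λ { refl → zy }) (last-∈ (last-suffix [ x ] end)))
  ...   | [] , r , R , refl , [] , zr = ⊥-elim (¬zx₁ zr)
  ...   | m ∷ ms , r , R , refl , ¬zms , zr =
    ⊥-elim (chordal _ (s≤s (s≤s (s≤s (length-++-≤ʳ [ r ] {ms}))))
                    (hole (m ∷ ms) (induced-prefix P R (subst InducedPath split path))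
                          (z∉ ∘ subst (z ∈ₗ_) (sym split) ∘ Any.++⁺ˡ) zx ¬zms zr))
    where
    P : List (Fin n)
    P = x ∷ m ∷ ms ++ [ r ]
    split : x ∷ m ∷ ms ++ r ∷ R ≡ P ++ R
    split = cong (λ L → x ∷ m ∷ L) (sym (++-assoc ms [ r ] R))

  InducedPathIn : Subset n → Fin n → List (Fin n) → Set
  InducedPathIn S v L = InducedPath L × Last v L × All (_∈ S) L

  path-suffix : ∀ {S v} pre {y R} → InducedPathIn S v (pre ++ y ∷ R) → InducedPathIn S v (y ∷ R)
  path-suffix pre (path , end , inS) = induced-suffix pre _ path , last-suffix pre end , All.++⁻ʳ pre inS

  -- Every walk of G[S] shortens to an induced path of G[S] with the same ends:
  -- shorten the rest of the walk, then cut it back to u if it revisits u and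
  -- otherwise to the last neighbour of u, and put u in front.
  shortcut : ∀ {S u v} → Walk G S u v → ∃ λ M → InducedPathIn S v (u ∷ M)
  shortcut (here u∈S) = [] , (tt , tt) , last-here , u∈S ∷ []
  shortcut {S} {u} {v} (step {w = w} u∈S uw W) with shortcut W
  ... | M , rest with Any.any? (u ≟ᶠ_) (w ∷ M)
  ...   | yes u∈ = let (pre , R , e) = ∈-∃++ u∈ in R , path-suffix pre (subst (InducedPathIn S v) e rest)
  ...   | no  u∉ =
    let (pre , y , R , e , uy , ¬u⋯) = last-hit (adj? u) (w ∷ M) (here uw)
        (path , end , inS) = path-suffix pre (subst (InducedPathIn S v) e rest)
    in y ∷ R , ((uy , ¬u⋯ , u∉ ∘ subst (u ∈ₗ_) (sym e) ∘ Any.++⁺ʳ pre) , path) , last-there end , u∈S ∷ inS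

  ∈-Nbh⁻ : ∀ {X v} → v ∈ Nbh G X → v ∉ X × ∃ λ u → u ∈ X × Adj G u v
  ∈-Nbh⁻ {X} {v} v∈N with Vec.lookup X v in Xv | trans (sym (lookup∘tabulate _ v)) ([]=⇒lookup v∈N)
  ... | false | has-nbr with anyV-sound _ has-nbr
  ...   | u , found with Vec.lookup X u in Xu
  ...     | true = (λ v∈X → false≢true (trans (sym Xv) ([]=⇒lookup v∈X))) , u , lookup⇒[]= u X Xu , found
    where
    false≢true : false ≢ true
    false≢true ()

  ∈-Nbh⁺ : ∀ {X u v} → v ∉ X → u ∈ X → Adj G u v → v ∈ Nbh G X
  ∈-Nbh⁺ {X} {u} {v} v∉X u∈X uv = lookup⇒[]= v (Nbh G X) (trans (lookup∘tabulate _ v) has-nbr)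
    where
    has-nbr : not (Vec.lookup X v) ∧ anyV (λ w → Vec.lookup X w ∧ adj G w v) ≡ true
    has-nbr rewrite ∉⇒lookup-false v∉X =
      anyV-complete _ u (trans (cong (_∧ adj G u v) ([]=⇒lookup u∈X)) uv)

  module _ (X : Subset n) where

    N : Subset n
    N = Nbh G X

    Far : Subset n
    Far = ∁ (X ∪ N)

    N⊆minus : N ⊆ minus X
    N⊆minus = x∉p⇒x∈∁p ∘ proj₁ ∘ ∈-Nbh⁻

    far⁻ : ∀ {v} → v ∈ Far → v ∉ X × v ∉ N
    far⁻ v∈Far = (λ v∈X → x∈∁p⇒x∉p v∈Far (x∈p∪q⁺ (inj₁ v∈X))) ,
                 (λ v∈N → x∈∁p⇒x∉p v∈Far (x∈p∪q⁺ (inj₂ v∈N)))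

    far⁺ : ∀ {v} → v ∉ X → v ∉ N → v ∈ Far
    far⁺ v∉X v∉N = x∉p⇒x∈∁p (Sum.[ v∉X , v∉N ] ∘ x∈p∪q⁻ X N)

    -- No edge joins Far to X, so a path in G[Far ∪ {c} ∪ X] from Far to X
    -- passes through c.
    passes-through : ∀ {c x y} xs → InducedPath (x ∷ xs) → All (_∈ Far ∪ (⁅ c ⁆ ∪ X)) (x ∷ xs) →
                     x ∈ Far → Last y (x ∷ xs) → y ∈ X → c ∈ₗ xs
    passes-through [] _ _ x∈Far last-here y∈X = ⊥-elim (proj₁ (far⁻ x∈Far) y∈X)
    passes-through {c} (x₁ ∷ xs) ((xx₁ , _) , path) (_ ∷ inS@(x₁∈S ∷ _)) x∈Far (last-there end) y∈X
      with x∈p∪q⁻ Far _ x₁∈S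
    ... | inj₁ x₁∈Far = there (passes-through xs path inS x₁∈Far end y∈X)
    ... | inj₂ x₁∈cX with x∈p∪q⁻ ⁅ c ⁆ X x₁∈cX
    ...   | inj₁ x₁≡c = here (sym (x∈⁅y⁆⇒x≡y c x₁≡c))
    ...   | inj₂ x₁∈X = ⊥-elim (proj₂ (far⁻ x∈Far) (∈-Nbh⁺ (proj₁ (far⁻ x∈Far)) x₁∈X (adj-sym xx₁)))

    -- Bridging lemma: if a, c ∈ N are joined by a walk a, t, …, u, c whose
    -- inner vertices lie in Far, then a = c or a ~ c.  Otherwise close the
    -- walk through X to an X-neighbour of a and shorten it to an induced
    -- path avoiding a; it passes through c, and chordal-fan makes a ~ c.
    bridge : Chordal G → Connected G X → ∀ {a c t u} → a ∈ N → c ∈ N →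
             Adj G a t → Walk G Far t u → Adj G u c → a ≡ c ⊎ Adj G a c
    bridge chordal (_ , X-walks) {a} {c} {t} a∈N c∈N at W uc with a ≟ᶠ c | ∈-Nbh⁻ a∈N | ∈-Nbh⁻ c∈N
    ... | yes a≡c | _ | _ = inj₁ a≡c
    ... | no a≢c | a∉X , x₁ , x₁∈X , x₁a | _ , x₀ , x₀∈X , x₀c =
      let (M , path , end , inS) = shortcut closing-walk
      in inj₂ (All.lookup (chordal-fan chordal M path (a∉S ∘ All.lookup inS) at end (adj-sym x₁a))
                          (passes-through M path inS (walk-start W) end x₁∈X))
      where
      S : Subset n
      S = Far ∪ (⁅ c ⁆ ∪ X)
      c∈S : c ∈ S
      c∈S = q⊆p∪q Far _ (p⊆p∪q X (x∈⁅x⁆ c))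
      closing-walk : Walk G S t x₁
      closing-walk = walk-++ (walk-snoc (walk-mono (p⊆p∪q _) W) uc c∈S)
                             (step c∈S (adj-sym x₀c) (walk-mono (q⊆p∪q Far _ ∘ q⊆p∪q ⁅ c ⁆ X)
                                                                (X-walks x₀ x₁ x₀∈X x₁∈X)))
      a∉S : a ∉ S
      a∉S = Sum.[ (λ a∈Far → proj₂ (far⁻ a∈Far) a∈N) ,
                  Sum.[ a≢c ∘ x∈⁅y⁆⇒x≡y c , a∉X ] ∘ x∈p∪q⁻ ⁅ c ⁆ X ] ∘ x∈p∪q⁻ Far _

    LeftFrom : Fin n → Fin n → Set
    LeftFrom a u = u ≡ a ⊎ ∃ λ t → Adj G a t × Walk G Far t u

    -- Rerouting: follow a walk of G - X, remembering the last vertex a of N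
    -- it visited; on re-entering N at w, bridge a to w inside G[N].
    reroute : Chordal G → Connected G X → ∀ {a u b} → a ∈ N → LeftFrom a u →
              Walk G (minus X) u b → b ∈ N → Walk G N a b
    reroute _ _ a∈N (inj₁ refl)         (here _) _   = here a∈N
    reroute _ _ _   (inj₂ (_ , _ , T)) (here _) b∈N = ⊥-elim (proj₂ (far⁻ (walk-end T)) b∈N)
    reroute chordal X-conn {a} {u} a∈N left (step {w = w} _ uw W) b∈N with w ∈? N
    ... | yes w∈N = walk-++ (edge-walk a∈N w∈N (a-to-w left)) (reroute chordal X-conn w∈N (inj₁ refl) W b∈N)
      where
      a-to-w : LeftFrom a u → a ≡ w ⊎ Adj G a w
      a-to-w (inj₁ refl)         = inj₂ uw
      a-to-w (inj₂ (_ , at , T)) = bridge chordal X-conn a∈N w∈N at T uw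
    ... | no w∉N = reroute chordal X-conn a∈N (extend left) W b∈N
      where
      w∈Far : w ∈ Far
      w∈Far = far⁺ (x∈∁p⇒x∉p (walk-start W)) w∉N
      extend : LeftFrom a u → LeftFrom a w
      extend (inj₁ refl)         = inj₂ (w , uw , here w∈Far)
      extend (inj₂ (t , at , T)) = inj₂ (t , at , walk-snoc T uw w∈Far)

    walk-within-N : Chordal G → Connected G X → ∀ {a b} → a ∈ N → b ∈ N →
                    Walk G (minus X) a b → Walk G N a b
    walk-within-N chordal X-conn a∈N b∈N W = reroute chordal X-conn a∈N (inj₁ refl) W b∈N

    exit-through-N : ∀ {u x} → Walk G full u x → u ∉ X → x ∈ X → ∃ λ w → w ∈ N × Walk G (minus X) u w
    exit-through-N (here _) u∉X x∈X = ⊥-elim (u∉X x∈X)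
    exit-through-N {u} (step {w = w} _ uw W) u∉X x∈X with w ∈? X
    ... | yes w∈X = u , ∈-Nbh⁺ u∉X w∈X (adj-sym uw) , here (x∉p⇒x∈∁p u∉X)
    ... | no  w∉X = let (v , v∈N , W′) = exit-through-N W w∉X x∈X in v , v∈N , step (x∉p⇒x∈∁p u∉X) uw W′

    -- The component map: enclosing C is the component of G - X through some
    -- vertex of C outside X (C itself if there is none, which never happens
    -- for a component of G[N]).
    OutsideVertex : Subset n → Set
    OutsideVertex C = ∃ λ v → v ∈ C × v ∈ minus X

    component-through : ∀ {C} → Dec (OutsideVertex C) → Subset n
    component-through     (yes (_ , _ , v∉X)) = proj₁ (component-of v∉X)
    component-through {C} (no _)               = C

    enclosing : Subset n → Subset n
    enclosing C = component-through (any? λ v → v ∈? C ×-dec v ∈? minus X)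

    enclosing-meets : ∀ {C} → OutsideVertex C →
                      IsComponent G (minus X) (enclosing C) × ∃ λ v → v ∈ C × v ∈ enclosing C
    enclosing-meets {C} = meets (any? λ v → v ∈? C ×-dec v ∈? minus X)
      where
      meets : (d : Dec (OutsideVertex C)) → OutsideVertex C →
              IsComponent G (minus X) (component-through d) × ∃ λ v → v ∈ C × v ∈ component-through d
      meets (yes (v , v∈C , v∉X)) _ = let (_ , H-comp , v∈H) = component-of v∉X in H-comp , v , v∈C , v∈H
      meets (no none) some = ⊥-elim (none some)

    N-component⊆minus : ∀ {C} → IsComponent G N C → C ⊆ minus X
    N-component⊆minus (C⊆N , _) = N⊆minus ∘ C⊆N

    N-component-outside : ∀ {C} → IsComponent G N C → OutsideVertex C
    N-component-outside C-comp@(_ , ((v , v∈C) , _) , _) = v , v∈C , N-component⊆minus C-comp v∈C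

    enclosing-component : ∀ {C} → IsComponent G N C → IsComponent G (minus X) (enclosing C)
    enclosing-component = proj₁ ∘ enclosing-meets ∘ N-component-outside

    ⊆-enclosing : ∀ {C} → IsComponent G N C → C ⊆ enclosing C
    ⊆-enclosing C-comp =
      let (H-comp , v , v∈C , v∈H) = enclosing-meets (N-component-outside C-comp)
      in component-absorbs H-comp (N-component⊆minus C-comp) (proj₁ (proj₂ C-comp)) v∈C v∈H

    enclosing-unique : ∀ {C H} → IsComponent G N C → IsComponent G (minus X) H → C ⊆ H → H ≡ enclosing C
    enclosing-unique C-comp H-comp C⊆H =
      let (H′-comp , v , v∈C , v∈H′) = enclosing-meets (N-component-outside C-comp)
      in component-unique H-comp H′-comp (C⊆H v∈C) v∈H′

    -- Injectivity: vertices v ∈ C, v′ ∈ C′ in a common component of G - X are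
    -- joined inside G[N], so v′ ∈ C and C = C′.
    enclosing-injective : Chordal G → Connected G X → ∀ {C C′} → IsComponent G N C → IsComponent G N C′ →
                          enclosing C ≡ enclosing C′ → C ≡ C′
    enclosing-injective chordal X-conn {C} {C′} C-comp@(C⊆N , ((v , v∈C) , _) , _) C′-comp@(C′⊆N , ((v′ , v′∈C′) , _) , _) same =
      component-unique C-comp C′-comp (closed-walk (component-closed C-comp) v∈C v⇝v′) v′∈C′
      where
      H-comp : IsComponent G (minus X) (enclosing C′)
      H-comp = enclosing-component C′-comp
      v⇝v′ : Walk G N v v′
      v⇝v′ = walk-within-N chordal X-conn (C⊆N v∈C) (C′⊆N v′∈C′)
               (walk-mono (proj₁ H-comp) (proj₂ (proj₁ (proj₂ H-comp)) v v′
                 (subst (v ∈_) same (⊆-enclosing C-comp v∈C)) (⊆-enclosing C′-comp v′∈C′)))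

    -- Surjectivity: a walk of G from a component H of G - X to X leaves H at
    -- a vertex of N; its component C in G[N] lies in H, so H = enclosing C.
    enclosing-surjective : Connected G full → Connected G X → ∀ {H} → IsComponent G (minus X) H →
                           ∃ λ C → IsComponent G N C × enclosing C ≡ H
    enclosing-surjective (_ , G-walks) ((x , x∈X) , _) H-comp@(H⊆minus , ((h , h∈H) , _) , _) =
      let (w , w∈N , h⇝w) = exit-through-N (G-walks h x ∈-full ∈-full) (x∈∁p⇒x∉p (H⊆minus h∈H)) x∈X
          (C , C-comp , w∈C) = component-of w∈N
          C⊆H = component-absorbs H-comp (N-component⊆minus C-comp) (proj₁ (proj₂ C-comp)) w∈C
                  (closed-walk (component-closed H-comp) h∈H h⇝w)
      in C , C-comp , sym (enclosing-unique C-comp H-comp C⊆H)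

lemma2p1 : ∀ {n} (G : Graph n) (X : Subset n) →
    Chordal G → Connected G full → Connected G X →
    Σ (Subset n → Subset n) λ f →
      (∀ C → IsComponent G (Nbh G X) C → IsComponent G (minus X) (f C)) ×
      (∀ C C′ → IsComponent G (Nbh G X) C → IsComponent G (Nbh G X) C′ →
         f C ≡ f C′ → C ≡ C′) ×
      (∀ H → IsComponent G (minus X) H →
         ∃ λ C → IsComponent G (Nbh G X) C × f C ≡ H) ×
      (∀ C H → IsComponent G (Nbh G X) C → IsComponent G (minus X) H →
         (C ⊆ H → H ≡ f C) × (H ≡ f C → C ⊆ H))
lemma2p1 G X chordal G-conn X-conn =
  enclosing G X ,
  (λ _ → enclosing-component G X) ,
  (λ _ _ → enclosing-injective G X chordal X-conn) ,
  (λ _ → enclosing-surjective G X G-conn X-conn) ,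
  λ _ _ C-comp H-comp → enclosing-unique G X C-comp H-comp ,
                        λ { refl → ⊆-enclosing G X C-comp }
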